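{- There exists an irreducible $(6,4)$-homogeneous subcube partition.
   Context: Subcubes of $\{0,1\}^n$ are identified with words in $\{0,1,*\}^n$; the codimension is the number of non-$*$ positions. A subcube partition of length $n$ is a partition of $\{0,1\}^n$ into subcubes; it is irreducible if no subset $G$ with $1<|G|<|F|$ has a union that is a subcube, and tight if for every coordinate $i$ some subcube $s$ has $s_i\ne*$. An $(n,k)$-homogeneous subcube partition is a tight subcube partition of length $n$ all of whose subcubes have codimension $k$. -}

module Defs where

open import Data.Nat using (ℕ; _<_)
open import Data.Bool using (Bool; true; false)
open import Data.Fin using (Fin)
open import Data.Fin.Subset using (Subset; ∣_∣) renaming (_∈_ to _∈ˢ_)
open import Data.Vec using (Vec; lookup; count)
open import Data.Product using (Σ; ∃; _×_)
open import Relation.Nullary using (¬_; Dec; yes; no)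
open import Relation.Binary.PropositionalEquality using (_≡_)
open import Data.Empty using (⊥)
open import Data.Unit using (⊤)
open import Function.Bundles using (_⇔_)

data Sym : Set where
  s0 s1 star : Sym

-- A subcube of {0,1}^n is a word in {0,1,*}^n.
Subcube : ℕ → Set
Subcube n = Vec Sym n

Point : ℕ → Set
Point n = Vec Bool n

matches : Bool → Sym → Set
matches false s0 = ⊤
matches true  s1 = ⊤
matches _     star = ⊤
matches _     _ = ⊥

_∈ᶜ_ : ∀ {n} → Point n → Subcube n → Set
_∈ᶜ_ {n} x s = ∀ (i : Fin n) → matches (lookup x i) (lookup s i)

isFixed : Sym → Bool
isFixed star = false
isFixed _ = true

isFixed? : (a : Sym) → Dec (isFixed a ≡ true)
isFixed? s0 = yes _≡_.refl
isFixed? s1 = yes _≡_.refl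
isFixed? star = no (λ ())

codim : ∀ {n} → Subcube n → ℕ
codim s = count isFixed? s

IsPartition : ∀ {n m} → (Fin m → Subcube n) → Set
IsPartition {n} {m} F =
  ∀ (x : Point n) →
    (∃ λ (j : Fin m) → x ∈ᶜ F j) ×
    (∀ (j j′ : Fin m) → x ∈ᶜ F j → x ∈ᶜ F j′ → j ≡ j′)

IsTight : ∀ {n m} → (Fin m → Subcube n) → Set
IsTight {n} {m} F = ∀ (i : Fin n) → ∃ λ (j : Fin m) → ¬ (lookup (F j) i ≡ star)

IsIrreducible : ∀ {n m} → (Fin m → Subcube n) → Set
IsIrreducible {n} {m} F =
  ∀ (G : Subset m) → 1 < ∣ G ∣ → ∣ G ∣ < m →
    ¬ (∃ λ (c : Subcube n) →
         ∀ (x : Point n) → (x ∈ᶜ c) ⇔ (∃ λ (j : Fin m) → (j ∈ˢ G) × (x ∈ᶜ F j)))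

IsHomogeneous : ∀ {m} (n k : ℕ) → (Fin m → Subcube n) → Set
IsHomogeneous {m} n k F = IsPartition F × IsTight F × (∀ (j : Fin m) → codim (F j) ≡ k)

-- The example is an explicit list of sixteen subcubes; homogeneity is a finite check.
-- For irreducibility, let G be a subfamily whose union is a subcube c.  Since the
-- family is a partition, G consists exactly of the members meeting c, and each of
-- them lies inside c.  So it suffices to check, for each of the 3^6 subcubes c, that
-- some member meets c without lying inside it, or that c meets every member (then
-- G is everything), or that c meets at most one member (then |G| ≤ 1).
module Submission where

open import Defs
open import Data.Bool using (Bool; true; false)
open import Data.Fin using (Fin; zero; suc; _≟_)
open import Data.Fin.Properties using (any?; all?)
open import Data.Fin.Subset using (Subset; ∣_∣; ⊤; ⁅_⁆; _⊆_) renaming (_∈_ to _∈ˢ_)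
open import Data.Fin.Subset.Properties using (∣⊤∣≡n; ∣⁅x⁆∣≡1; p⊆q⇒∣p∣≤∣q∣; x∈⁅x⁆)
open import Data.Nat using (ℕ; zero; suc; _≤_)
open import Data.Nat.Properties using (<⇒≱) renaming (_≟_ to _≟ℕ_)
open import Data.Product using (Σ; ∃; _×_; _,_; proj₁; proj₂)
open import Data.Sum using (_⊎_; inj₁; inj₂)
open import Data.Unit using (tt)
open import Data.Vec using (Vec; []; _∷_; lookup; tabulate; _[_]≔_)
open import Data.Vec.Properties using (lookup∘update; lookup∘update′; lookup∘tabulate)
open import Function.Bundles using (_⇔_; Equivalence; mk⇔)
open import Function.Properties.Equivalence using () renaming (sym to ⇔-sym)
open import Relation.Binary.PropositionalEquality using (_≡_; refl; subst; sym)
open import Relation.Nullary using (¬_; Dec; yes; no)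
import Relation.Nullary.Decidable as Dec
open import Relation.Nullary.Decidable using (map′; _×-dec_; _⊎-dec_; _→-dec_; ¬?; decidable-stable; from-yes)
open import Relation.Unary using (Decidable)

Searchable : Set → Set₁
Searchable A = ∀ {P : A → Set} → Decidable P → Dec (∃ P)

∀? : ∀ {A} → Searchable A → ∀ {P : A → Set} → Decidable P → Dec (∀ x → P x)
∀? search P? = map′
  (λ ∄¬P x → decidable-stable (P? x) (λ ¬Px → ∄¬P (x , ¬Px)))
  (λ ∀P (x , ¬Px) → ¬Px (∀P x))
  (¬? (search (λ x → ¬? (P? x))))

Bool-searchable : Searchable Bool
Bool-searchable P? = map′
  (λ { (inj₁ p) → false , p ; (inj₂ p) → true , p })
  (λ { (false , p) → inj₁ p ; (true , p) → inj₂ p })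
  (P? false ⊎-dec P? true)

Sym-searchable : Searchable Sym
Sym-searchable P? = map′
  (λ { (inj₁ p) → s0 , p ; (inj₂ (inj₁ p)) → s1 , p ; (inj₂ (inj₂ p)) → star , p })
  (λ { (s0 , p) → inj₁ p ; (s1 , p) → inj₂ (inj₁ p) ; (star , p) → inj₂ (inj₂ p) })
  (P? s0 ⊎-dec P? s1 ⊎-dec P? star)

Vec-searchable : ∀ {A} → Searchable A → ∀ n → Searchable (Vec A n)
Vec-searchable search zero P? = map′ ([] ,_) (λ { ([] , p) → p }) (P? [])
Vec-searchable search (suc n) P? = map′
  (λ { (a , v , p) → a ∷ v , p })
  (λ { (a ∷ v , p) → a , v , p })
  (search (λ a → Vec-searchable search n (λ v → P? (a ∷ v))))

matches? : ∀ b a → Dec (matches b a)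
matches? false s0   = yes tt
matches? false s1   = no λ ()
matches? false star = yes tt
matches? true  s0   = no λ ()
matches? true  s1   = yes tt
matches? true  star = yes tt

_∈ᶜ?_ : ∀ {n} (x : Point n) (s : Subcube n) → Dec (x ∈ᶜ s)
x ∈ᶜ? s = all? (λ i → matches? (lookup x i) (lookup s i))

star? : (a : Sym) → Dec (a ≡ star)
star? s0   = no λ ()
star? s1   = no λ ()
star? star = yes refl

lowest : Sym → Bool
lowest s1 = true
lowest _  = false

lowest-matches : ∀ a → matches (lowest a) a
lowest-matches s0   = tt
lowest-matches s1   = tt
lowest-matches star = tt

corner : ∀ {n} → Subcube n → Point n
corner []      = []
corner (a ∷ s) = lowest a ∷ corner s

corner-∈ᶜ : ∀ {n} (s : Subcube n) → corner s ∈ᶜ s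
corner-∈ᶜ (a ∷ s) zero    = lowest-matches a
corner-∈ᶜ (a ∷ s) (suc i) = corner-∈ᶜ s i

_⊆ᶜ_ : ∀ {n} → Subcube n → Subcube n → Set
s ⊆ᶜ t = ∀ x → x ∈ᶜ s → x ∈ᶜ t

Meets : ∀ {n} → Subcube n → Subcube n → Set
Meets s t = ∃ λ x → x ∈ᶜ s × x ∈ᶜ t

_⊑_ : Sym → Sym → Set
a ⊑ b = ∀ bit → matches bit a → matches bit b

Compatible : Sym → Sym → Set
Compatible a b = ∃ λ bit → matches bit a × matches bit b

-- A subcube is the product of its letters, so inclusion and meeting are coordinatewise.
⊆ᶜ⇔⊑ : ∀ {n} {s t : Subcube n} → s ⊆ᶜ t ⇔ (∀ i → lookup s i ⊑ lookup t i)
⊆ᶜ⇔⊑ {s = s} {t} = mk⇔ ⊆ᶜ⇒⊑ (λ s⊑t x x∈s i → s⊑t i (lookup x i) (x∈s i))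
  where
  ⊆ᶜ⇒⊑ : s ⊆ᶜ t → ∀ i → lookup s i ⊑ lookup t i
  ⊆ᶜ⇒⊑ s⊆t i bit bit∈sᵢ =
    subst (λ b → matches b (lookup t i)) (lookup∘update i (corner s) bit) (s⊆t x x∈s i)
    where
    x : Point _
    x = corner s [ i ]≔ bit
    x∈s : x ∈ᶜ s
    x∈s j with j ≟ i
    ... | yes refl = subst (λ b → matches b (lookup s i)) (sym (lookup∘update i (corner s) bit)) bit∈sᵢ
    ... | no j≢i   = subst (λ b → matches b (lookup s j)) (sym (lookup∘update′ j≢i (corner s) bit))
                           (corner-∈ᶜ s j)

meets⇔compatible : ∀ {n} {s t : Subcube n} → Meets s t ⇔ (∀ i → Compatible (lookup s i) (lookup t i))
meets⇔compatible {s = s} {t} =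
  mk⇔ (λ (x , x∈s , x∈t) i → lookup x i , x∈s i , x∈t i) compatible⇒meets
  where
  compatible⇒meets : (∀ i → Compatible (lookup s i) (lookup t i)) → Meets s t
  compatible⇒meets compatible = x , x∈s , x∈t
    where
    x : Point _
    x = tabulate (λ i → proj₁ (compatible i))
    x∈s : x ∈ᶜ s
    x∈s i = subst (λ b → matches b (lookup s i)) (sym (lookup∘tabulate _ i))
                  (proj₁ (proj₂ (compatible i)))
    x∈t : x ∈ᶜ t
    x∈t i = subst (λ b → matches b (lookup t i)) (sym (lookup∘tabulate _ i))
                  (proj₂ (proj₂ (compatible i)))

_⊆ᶜ?_ : ∀ {n} (s t : Subcube n) → Dec (s ⊆ᶜ t)
s ⊆ᶜ? t = Dec.map (⇔-sym (⊆ᶜ⇔⊑ {s = s} {t})) (all? λ i →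
  ∀? Bool-searchable λ bit → matches? bit (lookup s i) →-dec matches? bit (lookup t i))

meets? : ∀ {n} (s t : Subcube n) → Dec (Meets s t)
meets? s t = Dec.map (⇔-sym (meets⇔compatible {s = s} {t})) (all? λ i →
  Bool-searchable λ bit → matches? bit (lookup s i) ×-dec matches? bit (lookup t i))

homogeneous? : ∀ {m} n k (F : Fin m → Subcube n) → Dec (IsHomogeneous n k F)
homogeneous? n k F = partition? ×-dec tight? ×-dec all? (λ j → codim (F j) ≟ℕ k)
  where
  partition? : Dec (IsPartition F)
  partition? = ∀? (Vec-searchable Bool-searchable n) λ x →
    any? (λ j → x ∈ᶜ? F j) ×-dec
    all? (λ j → all? (λ j′ → x ∈ᶜ? F j →-dec x ∈ᶜ? F j′ →-dec j ≟ j′))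
  tight? : Dec (IsTight F)
  tight? = all? (λ i → any? (λ j → ¬? (star? (lookup (F j) i))))

module _ {n m} (F : Fin m → Subcube n) where

  Straddles MeetsAll MeetsAtMostOne : Subcube n → Set
  Straddles c      = ∃ λ j → Meets (F j) c × ¬ (F j ⊆ᶜ c)
  MeetsAll c       = ∀ j → Meets (F j) c
  MeetsAtMostOne c = ∃ λ j₀ → ∀ j → Meets (F j) c → j ≡ j₀

  classify? : ∀ c → Dec (Straddles c ⊎ MeetsAll c ⊎ MeetsAtMostOne c)
  classify? c =
    any? (λ j → meets? (F j) c ×-dec ¬? (F j ⊆ᶜ? c)) ⊎-dec
    all? (λ j → meets? (F j) c) ⊎-dec
    any? (λ j₀ → all? (λ j → meets? (F j) c →-dec j ≟ j₀))

  IsUnionOver : Subset m → Subcube n → Set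
  IsUnionOver G c = ∀ x → (x ∈ᶜ c) ⇔ (∃ λ j → (j ∈ˢ G) × (x ∈ᶜ F j))

  member-⊆ᶜ-union : ∀ {G c j} → IsUnionOver G c → j ∈ˢ G → F j ⊆ᶜ c
  member-⊆ᶜ-union c≡⋃G j∈G x x∈Fj = Equivalence.from (c≡⋃G x) (_ , j∈G , x∈Fj)

  module _ (partition : IsPartition F) where

    meeting-member-∈ : ∀ {G c j} → IsUnionOver G c → Meets (F j) c → j ∈ˢ G
    meeting-member-∈ {G} {j = j} c≡⋃G (x , x∈Fj , x∈c) with Equivalence.to (c≡⋃G x) x∈c
    ... | j′ , j′∈G , x∈Fj′ = subst (_∈ˢ G) (proj₂ (partition x) j′ j x∈Fj′ x∈Fj) j′∈G

    irreducible-if-classified :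
      (∀ c → Straddles c ⊎ MeetsAll c ⊎ MeetsAtMostOne c) → IsIrreducible F
    irreducible-if-classified classified G 1<∣G∣ ∣G∣<m (c , c≡⋃G) with classified c
    ... | inj₁ (j , Fj-meets-c , Fj⊈c) =
      Fj⊈c (member-⊆ᶜ-union {c = c} c≡⋃G (meeting-member-∈ {c = c} c≡⋃G Fj-meets-c))
    ... | inj₂ (inj₁ meets-all) =
      <⇒≱ ∣G∣<m (subst (_≤ ∣ G ∣) (∣⊤∣≡n m) (p⊆q⇒∣p∣≤∣q∣ ⊤⊆G))
      where
      ⊤⊆G : ⊤ ⊆ G
      ⊤⊆G {j} _ = meeting-member-∈ {c = c} c≡⋃G (meets-all j)
    ... | inj₂ (inj₂ (j₀ , only-j₀)) =
      <⇒≱ 1<∣G∣ (subst (∣ G ∣ ≤_) (∣⁅x⁆∣≡1 j₀) (p⊆q⇒∣p∣≤∣q∣ G⊆⁅j₀⁆))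
      where
      G⊆⁅j₀⁆ : G ⊆ ⁅ j₀ ⁆
      G⊆⁅j₀⁆ {j} j∈G = subst (_∈ˢ ⁅ j₀ ⁆) (sym (only-j₀ j Fj-meets-c)) (x∈⁅x⁆ j₀)
        where
        Fj-meets-c : Meets (F j) c
        Fj-meets-c = corner (F j) , corner-∈ᶜ (F j) ,
                     member-⊆ᶜ-union {c = c} c≡⋃G j∈G (corner (F j)) (corner-∈ᶜ (F j))

cubes : Vec (Subcube 6) 16
cubes =
  (star ∷ s0   ∷ star ∷ s0   ∷ s0   ∷ s0   ∷ []) ∷
  (star ∷ s0   ∷ s0   ∷ s0   ∷ star ∷ s1   ∷ []) ∷
  (s0   ∷ star ∷ star ∷ s0   ∷ s1   ∷ s0   ∷ []) ∷
  (s0   ∷ s0   ∷ s0   ∷ s1   ∷ star ∷ star ∷ []) ∷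
  (s0   ∷ s0   ∷ s1   ∷ star ∷ star ∷ s1   ∷ []) ∷
  (s0   ∷ star ∷ s1   ∷ s1   ∷ star ∷ s0   ∷ []) ∷
  (s0   ∷ s1   ∷ star ∷ s0   ∷ s0   ∷ star ∷ []) ∷
  (s0   ∷ s1   ∷ star ∷ star ∷ s1   ∷ s1   ∷ []) ∷
  (star ∷ s1   ∷ s0   ∷ s1   ∷ star ∷ s0   ∷ []) ∷
  (star ∷ s1   ∷ star ∷ s1   ∷ s0   ∷ s1   ∷ []) ∷
  (s1   ∷ s0   ∷ star ∷ star ∷ s1   ∷ s0   ∷ []) ∷
  (s1   ∷ s0   ∷ star ∷ s1   ∷ s0   ∷ star ∷ []) ∷
  (s1   ∷ star ∷ star ∷ s1   ∷ s1   ∷ s1   ∷ []) ∷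
  (s1   ∷ star ∷ s1   ∷ s0   ∷ star ∷ s1   ∷ []) ∷
  (s1   ∷ s1   ∷ s0   ∷ s0   ∷ star ∷ star ∷ []) ∷
  (s1   ∷ s1   ∷ s1   ∷ star ∷ star ∷ s0   ∷ []) ∷ []

cube : Fin 16 → Subcube 6
cube = lookup cubes

cube-homogeneous : IsHomogeneous 6 4 cube
cube-homogeneous = from-yes (homogeneous? 6 4 cube)

cube-classified : ∀ c → Straddles cube c ⊎ MeetsAll cube c ⊎ MeetsAtMostOne cube c
cube-classified = from-yes (∀? (Vec-searchable Sym-searchable 6) (classify? cube))

lemma2p57 : Σ ℕ λ m → Σ (Fin m → Subcube 6) λ F → IsHomogeneous 6 4 F × IsIrreducible F
lemma2p57 = 16 , cube , cube-homogeneous ,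
            irreducible-if-classified cube (proj₁ cube-homogeneous) cube-classified
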